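{- Let $G=(V,E)$ be a finite, simple, undirected, connected graph with at least two vertices, and let $X \subseteq V$ with $|X| = d \geq 3$ be such that $G[V\setminus X]$ is a disjoint union of cliques. If $X$ is an independent set and every vertex in $V\setminus X$ has at most one neighbor in $X$, then $\chi_{ON}(G) \leq d+1$.
   Context: A CFON coloring of a graph $G=(V,E)$ with $k$ colors is a map $C: V \to \{1,\dots,k\}$ such that for every $v \in V$ there is a color $i$ with $|N(v)\cap C^{ -1}(i)| = 1$, where $N(v)$ is the open neighborhood of $v$. $\chi_{ON}(G)$ is the minimum $k$ for which a CFON coloring with $k$ colors exists. -}

module Defs where

open import Data.Nat using (ℕ; zero; suc; _≤_)
open import Data.Bool using (Bool; true; false; _∧_)
open import Data.Fin using (Fin)
open import Data.Fin.Subset using (Subset; _∈_; _∉_; ∣_∣)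
open import Data.List using (List; length; filterᵇ; allFin)
open import Data.Product using (Σ; ∃; _×_)
open import Relation.Binary.PropositionalEquality using (_≡_; _≢_)
open import Relation.Nullary.Decidable using (⌊_⌋)
open import Function.Bundles using (_⇔_)
import Data.Fin as F
open import Data.Vec using (lookup)

record Graph (n : ℕ) : Set where
  field
    adj    : Fin n → Fin n → Bool
    sym    : ∀ u v → adj u v ≡ adj v u
    irrefl : ∀ v → adj v v ≡ false
open Graph public

data Walk {n : ℕ} (G : Graph n) : Fin n → Fin n → Set where
  here : ∀ {v} → Walk G v v
  step : ∀ {u w v} → adj G u w ≡ true → Walk G w v → Walk G u v

Connected : ∀ {n} → Graph n → Set
Connected G = ∀ u v → Walk G u v

countNbrs : ∀ {n} → Graph n → Fin n → (Fin n → Bool) → ℕ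
countNbrs {n} G v P = length (filterᵇ (λ u → adj G v u ∧ P u) (allFin n))

inSet : ∀ {n} → Subset n → Fin n → Bool
inSet X u = lookup X u

Independent : ∀ {n} → Graph n → Subset n → Set
Independent G X = ∀ u v → u ∈ X → v ∈ X → adj G u v ≡ false

-- G[V ∖ X] is a disjoint union of cliques: there is a labelling of vertices
-- (the clique a vertex belongs to) such that two distinct vertices outside X
-- are adjacent iff they carry the same label.
DisjointUnionOfCliquesOutside : ∀ {n} → Graph n → Subset n → Set
DisjointUnionOfCliquesOutside {n} G X =
  Σ (Fin n → ℕ) λ part → ∀ u v → u ∉ X → v ∉ X → u ≢ v →
    (adj G u v ≡ true) ⇔ (part u ≡ part v)

IsCFON : ∀ {n k} → Graph n → (Fin n → Fin k) → Set
IsCFON {n} {k} G C =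
  ∀ v → ∃ λ (i : Fin k) → countNbrs G v (λ u → ⌊ C u F.≟ i ⌋) ≡ 1

χON≤ : ∀ {n} → Graph n → ℕ → Set
χON≤ {n} G k = Σ (Fin n → Fin k) λ C → IsCFON G C

-- Four colours suffice, and d + 1 ≥ 4.  Colour X with 0.  In every clique of G − X pick a
-- vertex with a neighbour in X as its marker; one exists, since a clique none of whose
-- vertices has a neighbour in X is closed under adjacency, so by connectivity it would
-- contain X.  Each x ∈ X colours its first non-marker neighbour (its witness) 1.  A marker
-- is coloured 2 if it is the first neighbour of its X-neighbour and 3 otherwise; every
-- other vertex outside X gets the one of 2, 3 its clique's marker does not have.  Then
-- x ∈ X sees 1 exactly once, or, if all its neighbours are markers, 2 exactly once; a
-- vertex with its unique X-neighbour sees 0 exactly once; and any other vertex sees the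
-- colour of its marker exactly once.
module Submission where

open import Defs
open import Data.Bool using (Bool; true; false; _∧_; not; if_then_else_; T)
open import Data.Bool.Properties as Bool using (T-≡; not-¬; ¬-not)
open import Data.Fin as F using (Fin; zero; suc; #_; inject≤)
open import Data.Fin.Properties using (suc-injective; inject≤-injective)
open import Data.Fin.Subset using (Subset; _∈_; _∉_; ∣_∣; Nonempty)
open import Data.Fin.Subset.Properties using (nonempty?; Empty-unique; ∣⊥∣≡0)
open import Data.List using (length; filterᵇ; allFin; tabulate)
open import Data.List.Properties using (filter-≐)
open import Data.Maybe as Maybe using (Maybe; just; nothing; is-just; maybe′)
open import Data.Maybe.Properties using (just-injective) renaming (≡-dec to ≡-dec-Maybe)
open import Data.Nat as ℕ using (ℕ; _≤_; _+_; z≤n; s≤s)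
open import Data.Nat.Properties using (≤-trans; ≤-reflexive; +-monoˡ-≤)
open import Data.Product using (∃; _×_; _,_; proj₁; proj₂)
open import Data.Sum using (_⊎_; inj₁; inj₂)
open import Data.Vec.Properties using ([]=⇒lookup; lookup⇒[]=)
open import Function using (_∘_; id)
open import Function.Bundles using (_⇔_; Equivalence; mk⇔)
open import Relation.Binary.PropositionalEquality as ≡ using (_≡_; _≢_; refl; trans; cong)
open import Relation.Nullary using (Dec; yes; no; contradiction)
open import Relation.Unary using (_≐_)
open import Relation.Nullary.Decidable using (⌊_⌋; isYes≗does; does-⇔; toWitness; fromWitness; T?)

⌊⌋≡true⇒ : ∀ {A : Set} (a? : Dec A) → ⌊ a? ⌋ ≡ true → A
⌊⌋≡true⇒ a? e = toWitness {a? = a?} (Equivalence.from T-≡ e)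

⌊⌋≡true : ∀ {A : Set} (a? : Dec A) → A → ⌊ a? ⌋ ≡ true
⌊⌋≡true a? a = Equivalence.to T-≡ (fromWitness {a? = a?} a)

⌊⌋-⇔ : ∀ {A B : Set} → A ⇔ B → (a? : Dec A) (b? : Dec B) → ⌊ a? ⌋ ≡ ⌊ b? ⌋
⌊⌋-⇔ A⇔B a? b? = trans (isYes≗does a?) (trans (does-⇔ A⇔B a? b?) (≡.sym (isYes≗does b?)))

∧-true⁻ : ∀ {a b} → a ∧ b ≡ true → a ≡ true × b ≡ true
∧-true⁻ {true} {true} _ = refl , refl

not-true⁻ : ∀ {a} → not a ≡ true → a ≡ false
not-true⁻ {false} _ = refl

not-false⁻ : ∀ {a} → not a ≡ false → a ≡ true
not-false⁻ {true} _ = refl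

true≢false : true ≢ false
true≢false ()

count : ∀ {n} → (Fin n → Bool) → ℕ
count {ℕ.zero} Q = 0
count {ℕ.suc n} Q = (if Q zero then 1 else 0) + count (Q ∘ suc)

length-filterᵇ-tabulate : ∀ {n m} (Q : Fin m → Bool) (f : Fin n → Fin m) →
  length (filterᵇ Q (tabulate f)) ≡ count (Q ∘ f)
length-filterᵇ-tabulate {ℕ.zero} Q f = refl
length-filterᵇ-tabulate {ℕ.suc n} Q f with Q (f zero)
... | true = cong ℕ.suc (length-filterᵇ-tabulate Q (f ∘ suc))
... | false = length-filterᵇ-tabulate Q (f ∘ suc)

count≡0 : ∀ {n} (Q : Fin n → Bool) → (∀ a → Q a ≡ false) → count Q ≡ 0
count≡0 {ℕ.zero} Q none = refl
count≡0 {ℕ.suc n} Q none rewrite none zero = count≡0 (Q ∘ suc) (none ∘ suc)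

count≡1 : ∀ {n} (Q : Fin n → Bool) {a} → Q a ≡ true → (∀ b → Q b ≡ true → b ≡ a) → count Q ≡ 1
count≡1 {ℕ.suc n} Q {zero} Qa unique rewrite Qa = cong ℕ.suc (count≡0 (Q ∘ suc) rest)
  where
  rest : ∀ b → Q (suc b) ≡ false
  rest b with Q (suc b) in Qb
  ... | false = refl
  ... | true with () ← unique (suc b) Qb
count≡1 {ℕ.suc n} Q {suc a} Qa unique with Q zero in Q0
... | true with () ← unique zero Q0
... | false = count≡1 (Q ∘ suc) Qa λ b Qb → suc-injective (unique (suc b) Qb)

count-pos : ∀ {n} (Q : Fin n → Bool) {a} → Q a ≡ true → 1 ≤ count Q
count-pos Q {zero} Qa rewrite Qa = s≤s z≤n
count-pos Q {suc a} Qa with Q zero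
... | true = s≤s z≤n
... | false = count-pos (Q ∘ suc) Qa

count≤1⇒unique : ∀ {n} (Q : Fin n → Bool) → count Q ≤ 1 → ∀ {a b} → Q a ≡ true → Q b ≡ true → a ≡ b
count≤1⇒unique {ℕ.suc n} Q c≤1 {a} {b} Qa Qb with Q zero in Q0 | a | b
... | true | zero | zero = refl
... | true | zero | suc b′ with s≤s () ← ≤-trans (s≤s (count-pos (Q ∘ suc) Qb)) c≤1
... | true | suc a′ | _ with s≤s () ← ≤-trans (s≤s (count-pos (Q ∘ suc) Qa)) c≤1
... | false | zero | _ = contradiction (trans (≡.sym Qa) Q0) true≢false
... | false | suc _ | zero = contradiction (trans (≡.sym Qb) Q0) true≢false
... | false | suc a′ | suc b′ = cong suc (count≤1⇒unique (Q ∘ suc) c≤1 Qa Qb)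

first : ∀ {n} → (Fin n → Bool) → Maybe (Fin n)
first {ℕ.zero} Q = nothing
first {ℕ.suc n} Q = if Q zero then just zero else Maybe.map suc (first (Q ∘ suc))

first-just : ∀ {n} (Q : Fin n → Bool) {a} → first Q ≡ just a → Q a ≡ true
first-just {ℕ.suc n} Q e with Q zero in Q0
first-just {ℕ.suc n} Q refl | true = Q0
... | false with first (Q ∘ suc) in e′
first-just {ℕ.suc n} Q refl | false | just a = first-just (Q ∘ suc) e′

first-nothing : ∀ {n} (Q : Fin n → Bool) → first Q ≡ nothing → ∀ a → Q a ≡ false
first-nothing {ℕ.suc n} Q e a with Q zero in Q0
first-nothing {ℕ.suc n} Q () a | true
... | false with first (Q ∘ suc) in e′
first-nothing {ℕ.suc n} Q e zero | false | nothing = Q0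
first-nothing {ℕ.suc n} Q e (suc a) | false | nothing = first-nothing (Q ∘ suc) e′ a

first-complete : ∀ {n} (Q : Fin n → Bool) {a} → Q a ≡ true → ∃ λ b → first Q ≡ just b
first-complete Q {a} Qa with first Q in e
... | just b = b , refl
... | nothing = contradiction (trans (≡.sym Qa) (first-nothing Q e a)) true≢false

_≡ᵇjust_ : ∀ {n} → Maybe (Fin n) → Fin n → Bool
m ≡ᵇjust b = ⌊ ≡-dec-Maybe F._≟_ m (just b) ⌋

≡ᵇjust-refl : ∀ {n} (b : Fin n) → just b ≡ᵇjust b ≡ true
≡ᵇjust-refl b = ⌊⌋≡true (≡-dec-Maybe F._≟_ (just b) (just b)) refl

≡ᵇjust⇒≡ : ∀ {n} (m : Maybe (Fin n)) b → m ≡ᵇjust b ≡ true → m ≡ just b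
≡ᵇjust⇒≡ m b = ⌊⌋≡true⇒ (≡-dec-Maybe F._≟_ m (just b))

inSet≡true⇒∈ : ∀ {n} (X : Subset n) {u} → inSet X u ≡ true → u ∈ X
inSet≡true⇒∈ X {u} = lookup⇒[]= u X

inSet≡false⇒∉ : ∀ {n} (X : Subset n) {u} → inSet X u ≡ false → u ∉ X
inSet≡false⇒∉ X u∉X u∈X = true≢false (trans (≡.sym ([]=⇒lookup u∈X)) u∉X)

∣p∣≥1⇒nonempty : ∀ {n} (p : Subset n) → 1 ≤ ∣ p ∣ → Nonempty p
∣p∣≥1⇒nonempty {n} p 1≤∣p∣ with nonempty? p
... | yes ne = ne
... | no empty = contradiction (≤-trans 1≤∣p∣ (≤-reflexive ∣p∣≡0)) λ ()
  where
  ∣p∣≡0 = trans (cong ∣_∣ (Empty-unique empty)) (∣⊥∣≡0 n)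

module _ {n} (G : Graph n) where

  adj⇒≢ : ∀ {u v} → adj G u v ≡ true → u ≢ v
  adj⇒≢ {u} e refl = true≢false (trans (≡.sym e) (irrefl G u))

  adj-sym : ∀ {u v} → adj G u v ≡ true → adj G v u ≡ true
  adj-sym {u} {v} e = trans (Graph.sym G v u) e

  walk-preserves : (S : Fin n → Set) → (∀ {u t} → S u → adj G u t ≡ true → S t) →
    ∀ {u v} → Walk G u v → S u → S v
  walk-preserves S closed here Su = Su
  walk-preserves S closed (step e w) Su = walk-preserves S closed w (closed Su e)

  walk⇒nbr : ∀ {u v} → Walk G u v → u ≢ v → ∃ λ t → adj G u t ≡ true
  walk⇒nbr here u≢v = contradiction refl u≢v
  walk⇒nbr (step {w = t} e _) _ = t , e

  connected⇒nbr : 2 ≤ n → Connected G → ∀ v → ∃ λ u → adj G v u ≡ true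
  connected⇒nbr (s≤s (s≤s _)) conn zero = walk⇒nbr (conn zero (suc zero)) λ ()
  connected⇒nbr (s≤s (s≤s _)) conn (suc v) = walk⇒nbr (conn (suc v) zero) λ ()

  countNbrs≡count : ∀ v P → countNbrs G v P ≡ count (λ u → adj G v u ∧ P u)
  countNbrs≡count v P = length-filterᵇ-tabulate (λ u → adj G v u ∧ P u) id

  countNbrs-cong : ∀ {v P Q} → (∀ u → P u ≡ Q u) → countNbrs G v P ≡ countNbrs G v Q
  countNbrs-cong {v} {P} {Q} P≗Q =
    cong length (filter-≐ (T? ∘ P′) (T? ∘ Q′) P′≐Q′ (allFin n))
    where
    P′ Q′ : Fin n → Bool
    P′ u = adj G v u ∧ P u
    Q′ u = adj G v u ∧ Q u
    eq : ∀ u → P′ u ≡ Q′ u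
    eq u = cong (adj G v u ∧_) (P≗Q u)
    P′≐Q′ : (T ∘ P′) ≐ (T ∘ Q′)
    P′≐Q′ = (λ {u} → ≡.subst T (eq u)) , (λ {u} → ≡.subst T (≡.sym (eq u)))

  UniquelyColouredNbr : ∀ {k} → (Fin n → Fin k) → Fin n → Set
  UniquelyColouredNbr C v =
    ∃ λ a → adj G v a ≡ true × (∀ b → adj G v b ≡ true → C b ≡ C a → b ≡ a)

  uniquelyColouredNbrs⇒IsCFON : ∀ {k} (C : Fin n → Fin k) →
    (∀ v → UniquelyColouredNbr C v) → IsCFON G C
  uniquelyColouredNbrs⇒IsCFON C nbrs v with nbrs v
  ... | a , va , unique =
    C a , trans (countNbrs≡count v _) (count≡1 _ Qa λ b Qb → coloured b (∧-true⁻ Qb))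
    where
    Qa : adj G v a ∧ ⌊ C a F.≟ C a ⌋ ≡ true
    Qa rewrite va = ⌊⌋≡true (C a F.≟ C a) refl
    coloured : ∀ b → adj G v b ≡ true × ⌊ C b F.≟ C a ⌋ ≡ true → b ≡ a
    coloured b (vb , Cb) = unique b vb (⌊⌋≡true⇒ (C b F.≟ C a) Cb)

  χON≤-mono : ∀ {k k′} → k ≤ k′ → χON≤ G k → χON≤ G k′
  χON≤-mono k≤k′ (C , cfon) = (λ u → inject≤ (C u) k≤k′) , λ v →
    let i , one = cfon v in
    inject≤ i k≤k′ , trans (countNbrs-cong λ u → ⌊⌋-⇔ (inject≤-≡ (C u) i) _ _) one
    where
    inject≤-≡ : ∀ a b → (inject≤ a k≤k′ ≡ inject≤ b k≤k′) ⇔ (a ≡ b)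
    inject≤-≡ a b = mk⇔ (inject≤-injective k≤k′ k≤k′ a b) (cong (λ c → inject≤ c k≤k′))

shade : Bool → Fin 4
shade true = # 2
shade false = # 3

shade≢0 : ∀ b → shade b ≢ # 0
shade≢0 true ()
shade≢0 false ()

shade≢1 : ∀ b → shade b ≢ # 1
shade≢1 true ()
shade≢1 false ()

shade-injective : ∀ {a b} → shade a ≡ shade b → a ≡ b
shade-injective {true} {true} _ = refl
shade-injective {false} {false} _ = refl

module FourColouring {n} (G : Graph n) (X : Subset n) (part : Fin n → ℕ)
  (cliques : ∀ u v → u ∉ X → v ∉ X → u ≢ v → (adj G u v ≡ true) ⇔ (part u ≡ part v))
  (independent : Independent G X)
  (atMostOneXNbr : ∀ v → v ∉ X → countNbrs G v (inSet X) ≤ 1)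
  where

  X-nbr∉X : ∀ {v u} → inSet X v ≡ true → adj G v u ≡ true → inSet X u ≡ false
  X-nbr∉X {v} {u} v∈X vu with inSet X u in u∈X
  ... | false = refl
  ... | true = contradiction (trans (≡.sym vu) vu≡false) true≢false
    where
    vu≡false = independent v u (inSet≡true⇒∈ X v∈X) (inSet≡true⇒∈ X u∈X)

  clique : ∀ {u t} → inSet X u ≡ false → inSet X t ≡ false → u ≢ t →
    (adj G u t ≡ true) ⇔ (part u ≡ part t)
  clique u∉X t∉X = cliques _ _ (inSet≡false⇒∉ X u∉X) (inSet≡false⇒∉ X t∉X)

  same-clique : ∀ {u t} → inSet X u ≡ false → inSet X t ≡ false →
    adj G u t ≡ true → part u ≡ part t
  same-clique u∉X t∉X ut = Equivalence.to (clique u∉X t∉X (adj⇒≢ G ut)) ut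

  clique-adj : ∀ {u t} → inSet X u ≡ false → inSet X t ≡ false → u ≢ t →
    part u ≡ part t → adj G u t ≡ true
  clique-adj u∉X t∉X u≢t = Equivalence.from (clique u∉X t∉X u≢t)

  xNbr : Fin n → Maybe (Fin n)
  xNbr u = first (λ w → adj G u w ∧ inSet X w)

  xNbr-just : ∀ {u x} → xNbr u ≡ just x → adj G u x ≡ true × inSet X x ≡ true
  xNbr-just e = ∧-true⁻ (first-just _ e)

  xNbr-nothing : ∀ {u x} → xNbr u ≡ nothing → adj G u x ≡ true → inSet X x ≡ false
  xNbr-nothing {u} {x} e ux with first-nothing _ e x
  ... | r rewrite ux = r

  xNbr-unique : ∀ {u x} → inSet X u ≡ false → adj G u x ≡ true → inSet X x ≡ true → xNbr u ≡ just x
  xNbr-unique {u} {x} u∉X ux x∈X =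
    trans found (cong just (count≤1⇒unique _ one (first-just _ found) Qx))
    where
    Qx : adj G u x ∧ inSet X x ≡ true
    Qx rewrite ux = x∈X
    found = proj₂ (first-complete _ Qx)
    one = ≡.subst (_≤ 1) (countNbrs≡count G u (inSet X)) (atMostOneXNbr u (inSet≡false⇒∉ X u∉X))

  xNbr-of-X-nbr : ∀ {v u} → inSet X v ≡ true → adj G v u ≡ true → xNbr u ≡ just v
  xNbr-of-X-nbr v∈X vu = xNbr-unique (X-nbr∉X v∈X vu) (adj-sym G vu) v∈X

  Candidate : ℕ → Fin n → Bool
  Candidate p u = not (inSet X u) ∧ (⌊ part u ℕ.≟ p ⌋ ∧ is-just (xNbr u))

  marker : Fin n → Maybe (Fin n)
  marker u = first (Candidate (part u))

  isMarker : Fin n → Bool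
  isMarker u = marker u ≡ᵇjust u

  marker-cong : ∀ {u v} → part u ≡ part v → marker u ≡ marker v
  marker-cong = cong (first ∘ Candidate)

  marker-just : ∀ {v m} → marker v ≡ just m →
    inSet X m ≡ false × part m ≡ part v × is-just (xNbr m) ≡ true
  marker-just e with ∧-true⁻ (first-just _ e)
  ... | m∉X , rest with ∧-true⁻ rest
  ... | same , hasX = not-true⁻ m∉X , ⌊⌋≡true⇒ (_ ℕ.≟ _) same , hasX

  marker-isMarker : ∀ {v m} → marker v ≡ just m → isMarker m ≡ true
  marker-isMarker {v} {m} e
    rewrite marker-cong {m} {v} (proj₁ (proj₂ (marker-just e))) | e = ≡ᵇjust-refl m

  isMarker⇒≡ : ∀ {b m} → marker b ≡ just m → isMarker b ≡ true → b ≡ m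
  isMarker⇒≡ {b} e mk = just-injective (trans (≡.sym (≡ᵇjust⇒≡ _ b mk)) e)

  Unmarked : Fin n → Set
  Unmarked u = inSet X u ≡ false × xNbr u ≡ nothing × marker u ≡ nothing

  unmarked-closed : ∀ {u t} → Unmarked u → adj G u t ≡ true → Unmarked t
  unmarked-closed {u} {t} (u∉X , noX , noMarker) ut = t∉X , tNoX , tNoMarker
    where
    t∉X = xNbr-nothing noX ut
    tNoMarker : marker t ≡ nothing
    tNoMarker = trans (marker-cong (≡.sym (same-clique u∉X t∉X ut))) noMarker
    tNoX : xNbr t ≡ nothing
    tNoX with xNbr t | first-nothing _ tNoMarker t
    ... | nothing | _ = refl
    ... | just _ | notCandidate rewrite t∉X | ⌊⌋≡true (part t ℕ.≟ part t) refl
      with () ← notCandidate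

  witness : Fin n → Maybe (Fin n)
  witness x = first (λ u → adj G x u ∧ not (isMarker u))

  isWitness : Fin n → Bool
  isWitness u = maybe′ (λ x → witness x ≡ᵇjust u) false (xNbr u)

  markerShade : Fin n → Bool
  markerShade m = maybe′ (λ x → first (adj G x) ≡ᵇjust m) false (xNbr m)

  cliqueShade : Fin n → Bool
  cliqueShade u = maybe′ markerShade false (marker u)

  colour : Fin n → Fin 4
  colour u =
    if inSet X u then # 0
    else if isMarker u then shade (markerShade u)
    else if isWitness u then # 1
    else shade (not (cliqueShade u))

  colour-X : ∀ {u} → inSet X u ≡ true → colour u ≡ # 0
  colour-X u∈X rewrite u∈X = refl

  colour-marker : ∀ {u} → inSet X u ≡ false → isMarker u ≡ true → colour u ≡ shade (markerShade u)
  colour-marker u∉X mk rewrite u∉X | mk = refl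

  colour-witness : ∀ {u} → inSet X u ≡ false → isMarker u ≡ false → isWitness u ≡ true →
    colour u ≡ # 1
  colour-witness u∉X mk wt rewrite u∉X | mk | wt = refl

  colour-unmarked : ∀ {u} → inSet X u ≡ false → isMarker u ≡ false →
    colour u ≡ # 1 ⊎ colour u ≡ shade (not (cliqueShade u))
  colour-unmarked {u} u∉X mk rewrite u∉X | mk with isWitness u
  ... | true = inj₁ refl
  ... | false = inj₂ refl

  colour≡0⇒∈X : ∀ u → colour u ≡ # 0 → inSet X u ≡ true
  colour≡0⇒∈X u c with inSet X u | isMarker u | isWitness u
  ... | true | _ | _ = refl
  ... | false | true | _ = contradiction c (shade≢0 (markerShade u))
  ... | false | false | true with () ← c
  ... | false | false | false = contradiction c (shade≢0 (not (cliqueShade u)))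

  colour≡1⇒witness : ∀ u → colour u ≡ # 1 → isWitness u ≡ true
  colour≡1⇒witness u c with inSet X u | isMarker u | isWitness u
  ... | true | _ | _ with () ← c
  ... | false | true | _ = contradiction c (shade≢1 (markerShade u))
  ... | false | false | true = refl
  ... | false | false | false = contradiction c (shade≢1 (not (cliqueShade u)))

  colour-in-marked-clique : ∀ {b m} → inSet X b ≡ false → marker b ≡ just m →
    colour b ≡ shade (markerShade m) → b ≡ m
  colour-in-marked-clique {b} {m} b∉X e c with isMarker b Bool.≟ true
  ... | yes mk = isMarker⇒≡ e mk
  ... | no ¬mk with colour-unmarked b∉X (¬-not ¬mk)
  ...   | inj₁ c₁ = contradiction (trans (≡.sym c) c₁) (shade≢1 (markerShade m))
  ...   | inj₂ c₂ =
    contradiction (shade-injective {markerShade m} (trans (≡.sym c) c₂′)) (not-¬ refl)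
    where
    c₂′ : colour b ≡ shade (not (markerShade m))
    c₂′ = trans c₂ (cong (λ s → shade (not (maybe′ markerShade false s))) e)

  witness-uniquely-coloured : ∀ {v w} → inSet X v ≡ true → witness v ≡ just w →
    UniquelyColouredNbr G colour v
  witness-uniquely-coloured {v} {w} v∈X e = w , vw , unique
    where
    vw = proj₁ (∧-true⁻ (first-just _ e))
    w∉X = X-nbr∉X v∈X vw
    isWitness-w : isWitness w ≡ true
    isWitness-w rewrite xNbr-of-X-nbr v∈X vw | e = ≡ᵇjust-refl w
    colour-w : colour w ≡ # 1
    colour-w = colour-witness w∉X (not-true⁻ (proj₂ (∧-true⁻ (first-just _ e)))) isWitness-w
    unique : ∀ b → adj G v b ≡ true → colour b ≡ colour w → b ≡ w
    unique b vb c with colour≡1⇒witness b (trans c colour-w)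
    ... | wb rewrite xNbr-of-X-nbr v∈X vb =
      ≡.sym (just-injective (trans (≡.sym e) (≡ᵇjust⇒≡ _ b wb)))

  first-nbr-uniquely-coloured : ∀ {v t} → inSet X v ≡ true → witness v ≡ nothing →
    adj G v t ≡ true → UniquelyColouredNbr G colour v
  first-nbr-uniquely-coloured {v} v∈X e vt with first-complete (adj G v) vt
  ... | s , es = s , vs , unique
    where
    vs = first-just _ es
    nbr-isMarker : ∀ {u} → adj G v u ≡ true → isMarker u ≡ true
    nbr-isMarker {u} vu with first-nothing _ e u
    ... | r rewrite vu = not-false⁻ r
    colour-nbr : ∀ {u} → adj G v u ≡ true → colour u ≡ shade (first (adj G v) ≡ᵇjust u)
    colour-nbr {u} vu rewrite colour-marker (X-nbr∉X v∈X vu) (nbr-isMarker vu)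
                            | xNbr-of-X-nbr v∈X vu = refl
    colour-s : colour s ≡ shade true
    colour-s rewrite colour-nbr vs | es = cong shade (≡ᵇjust-refl s)
    unique : ∀ b → adj G v b ≡ true → colour b ≡ colour s → b ≡ s
    unique b vb c = ≡.sym (just-injective (trans (≡.sym es) (≡ᵇjust⇒≡ _ b first≡ᵇjust-b)))
      where
      first≡ᵇjust-b = shade-injective (trans (≡.sym (colour-nbr vb)) (trans c colour-s))

  xNbr-uniquely-coloured : ∀ {v x} → inSet X v ≡ false → xNbr v ≡ just x →
    UniquelyColouredNbr G colour v
  xNbr-uniquely-coloured {v} {x} v∉X e = x , vx , unique
    where
    vx = proj₁ (xNbr-just e)
    unique : ∀ b → adj G v b ≡ true → colour b ≡ colour x → b ≡ x
    unique b vb c = just-injective (trans (≡.sym (xNbr-unique v∉X vb b∈X)) e)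
      where
      b∈X = colour≡0⇒∈X b (trans c (colour-X (proj₂ (xNbr-just e))))

  marker-uniquely-coloured : ∀ {v m} → inSet X v ≡ false → xNbr v ≡ nothing →
    marker v ≡ just m → UniquelyColouredNbr G colour v
  marker-uniquely-coloured {v} {m} v∉X noX e = m , vm , unique
    where
    m∉X = proj₁ (marker-just e)
    mv = proj₁ (proj₂ (marker-just e))
    v≢m : v ≢ m
    v≢m refl with () ← trans (≡.sym (proj₂ (proj₂ (marker-just e)))) (cong is-just noX)
    vm = clique-adj v∉X m∉X v≢m (≡.sym mv)
    unique : ∀ b → adj G v b ≡ true → colour b ≡ colour m → b ≡ m
    unique b vb c = colour-in-marked-clique b∉X mb (trans c (colour-marker m∉X (marker-isMarker e)))
      where
      b∉X = xNbr-nothing noX vb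
      mb = trans (marker-cong (≡.sym (same-clique v∉X b∉X vb))) e

  uniquely-coloured : (∀ v → ∃ λ u → adj G v u ≡ true) → Connected G → Nonempty X →
    ∀ v → UniquelyColouredNbr G colour v
  uniquely-coloured hasNbr conn (x₀ , x₀∈X) v with inSet X v in v∈X
  ... | true with witness v in ew
  ...   | just w = witness-uniquely-coloured v∈X ew
  ...   | nothing = first-nbr-uniquely-coloured v∈X ew (proj₂ (hasNbr v))
  uniquely-coloured hasNbr conn (x₀ , x₀∈X) v | false with xNbr v in ex
  ... | just x = xNbr-uniquely-coloured v∈X ex
  ... | nothing with marker v in em
  ...   | just m = marker-uniquely-coloured v∈X ex em
  ...   | nothing = contradiction (trans (≡.sym ([]=⇒lookup x₀∈X)) x₀∉X) true≢false
    where
    x₀∉X = proj₁ (walk-preserves G Unmarked unmarked-closed (conn v x₀) (v∈X , ex , em))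

lemma6 : (n : ℕ) (G : Graph n) → 2 ≤ n → Connected G →
    (d : ℕ) (X : Subset n) → ∣ X ∣ ≡ d → 3 ≤ d →
    DisjointUnionOfCliquesOutside G X →
    Independent G X →
    (∀ v → v ∉ X → countNbrs G v (inSet X) ≤ 1) →
    χON≤ G (d + 1)
lemma6 n G 2≤n conn d X ∣X∣≡d 3≤d (part , cliques) independent atMostOneXNbr =
  χON≤-mono G (+-monoˡ-≤ 1 3≤d) (colour , uniquelyColouredNbrs⇒IsCFON G colour nbrs)
  where
  open FourColouring G X part cliques independent atMostOneXNbr
  X-nonempty = ∣p∣≥1⇒nonempty X (≤-trans (s≤s z≤n) (≡.subst (3 ≤_) (≡.sym ∣X∣≡d) 3≤d))
  nbrs = uniquely-coloured (connected⇒nbr G 2≤n conn) conn X-nonempty
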